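{- Let \((X,d)\) be an ultrametric space, let \(A\), \(B\) be disjoint proximinal subsets of \(X\), and let \(G=G_{X,d}(A,B)\) be the corresponding proximinal graph. Then the following are equivalent: (i) \(\operatorname{diam}(B)\le\operatorname{dist}(A,B)\); (ii) \(G\) is nonempty and \(G'\) is a complete bipartite graph with \(B\subseteq V(G')\).
   Context: An ultrametric on a nonempty set \(X\) is a function \(d\colon X\times X\to[0,\infty)\) with \(d(x,y)=d(y,x)\), \(d(x,y)=0\iff x=y\) and \(d(x,y)\le\max\{d(x,z),d(z,y)\}\) for all \(x,y,z\). A set \(A\subseteq X\) is proximinal if for every \(x\in X\) there is \(a_0\in A\) with \(d(x,a_0)=\inf\{d(x,a)\colon a\in A\}\). \(\operatorname{dist}(A,B)=\inf\{d(a,b)\colon a\in A,b\in B\}\), \(\operatorname{diam}(B)=\sup\{d(x,y)\colon x,y\in B\}\). \(G_{X,d}(A,B)\) is the bipartite graph with vertex set \(A\cup B\) and parts \(A\), \(B\), in which \(a\in A\), \(b\in B\) are adjacent iff \(d(a,b)=\operatorname{dist}(A,B)\). A graph is nonempty if it has an edge. For a nonempty graph \(G\), \(G'\) is the subgraph whose vertices are the non-isolated vertices of \(G\) and with \(E(G')=E(G)\). A complete bipartite graph is a bipartite graph (two nonempty disjoint parts, edges only between parts) in which every two vertices from different parts are adjacent. -}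

module Defs where

open import Level using (0ℓ)
open import Data.Product using (Σ; ∃; _×_; _,_)
open import Data.Sum using (_⊎_)
open import Data.Empty using (⊥)
open import Relation.Binary.PropositionalEquality using (_≡_)
open import Relation.Binary.Structures using (IsTotalOrder)
open import Relation.Nullary using (¬_)
open import Algebra.Structures using (IsCommutativeRing)

-- The real numbers, axiomatised as a Dedekind-complete ordered field
-- (unique up to isomorphism).  Subsets of ℝ are predicates ℝ → Set.

record RealNumbers : Set₁ where
  infixl 6 _+_
  infixl 7 _*_
  infix 4 _≤_
  field
    ℝ   : Set
    0r  : ℝ
    1r  : ℝ
    _+_ : ℝ → ℝ → ℝ
    _*_ : ℝ → ℝ → ℝ
    -_  : ℝ → ℝ
    _≤_ : ℝ → ℝ → Set
    isCommutativeRing : IsCommutativeRing _≡_ _+_ _*_ -_ 0r 1r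
    0≢1        : ¬ (0r ≡ 1r)
    inverse    : ∀ x → ¬ (x ≡ 0r) → Σ ℝ (λ y → x * y ≡ 1r)
    isTotalOrder : IsTotalOrder _≡_ _≤_
    +-mono-≤   : ∀ x y z → x ≤ y → x + z ≤ y + z
    *-nonneg   : ∀ x y → 0r ≤ x → 0r ≤ y → 0r ≤ x * y
    complete   : (S : ℝ → Set) → (∃ λ s → S s) →
                 (∃ λ u → ∀ s → S s → s ≤ u) →
                 ∃ λ l → (∀ s → S s → s ≤ l) ×
                         (∀ u → (∀ s → S s → s ≤ u) → l ≤ u)

module Metric (R : RealNumbers) where
  open RealNumbers R

  IsInf : (ℝ → Set) → ℝ → Set
  IsInf S r = (∀ s → S s → r ≤ s) × (∀ l → (∀ s → S s → l ≤ s) → l ≤ r)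

  IsSup : (ℝ → Set) → ℝ → Set
  IsSup S r = (∀ s → S s → s ≤ r) × (∀ u → (∀ s → S s → s ≤ u) → r ≤ u)

  record IsUltrametric (X : Set) (d : X → X → ℝ) : Set where
    field
      nonempty : X
      nonneg   : ∀ x y → 0r ≤ d x y
      sym      : ∀ x y → d x y ≡ d y x
      zero⇔    : ∀ x y → (d x y ≡ 0r → x ≡ y) × (x ≡ y → d x y ≡ 0r)
      ultra    : ∀ x y z → d x y ≤ d x z ⊎ d x y ≤ d z y
                 -- i.e. d(x,y) ≤ max{d(x,z), d(z,y)}

  module _ {X : Set} (d : X → X → ℝ) where

    DistsTo : X → (X → Set) → ℝ → Set
    DistsTo x A r = ∃ λ a → A a × d x a ≡ r

    Proximinal : (X → Set) → Set
    Proximinal A = ∀ x → ∃ λ a₀ → A a₀ × IsInf (DistsTo x A) (d x a₀)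

    Disjoint : (X → Set) → (X → Set) → Set
    Disjoint A B = ∀ x → A x → B x → ⊥

    DistsBetween : (X → Set) → (X → Set) → ℝ → Set
    DistsBetween A B r = ∃ λ a → ∃ λ b → A a × B b × d a b ≡ r

    IsDist : (X → Set) → (X → Set) → ℝ → Set
    IsDist A B δ = IsInf (DistsBetween A B) δ

    -- diam(B) ≤ δ  (diam(B) is a finite supremum bounded by δ)
    DiamLe : (X → Set) → ℝ → Set
    DiamLe B δ = ∃ λ s → IsSup (DistsBetween B B) s × s ≤ δ

-- Bipartite graphs on a vertex type V with vertex set given by a predicate.
-- Edge u v means u (in the left part) is adjacent to v (in the right part).

record BipGraph (V : Set) : Set₁ where
  field
    Vert  : V → Set
    Left  : V → Set
    Right : V → Set
    Edge  : V → V → Set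

module _ {V : Set} (G : BipGraph V) where
  open BipGraph G

  NonemptyGraph : Set
  NonemptyGraph = ∃ λ u → ∃ λ v → Edge u v

  NonIsolated : V → Set
  NonIsolated v = Vert v × ∃ λ w → Edge v w ⊎ Edge w v

  prime : BipGraph V
  prime = record { Vert = NonIsolated
                 ; Left = λ v → Left v × NonIsolated v
                 ; Right = λ v → Right v × NonIsolated v
                 ; Edge = Edge }

  IsCompleteBipartite : Set
  IsCompleteBipartite =
    (∃ λ v → Left v) × (∃ λ v → Right v) ×
    (∀ v → Left v → Right v → ⊥) ×
    (∀ v → Vert v → Left v ⊎ Right v) ×
    (∀ v → Left v ⊎ Right v → Vert v) ×
    (∀ u v → Edge u v → Left u × Right v) ×
    (∀ u v → Left u → Right v → Edge u v)

-- G_{X,d}(A,B), where δ = dist(A,B)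
module _ (R : RealNumbers) where
  open RealNumbers R
  proximinalGraph : {X : Set} → (X → X → ℝ) → (X → Set) → (X → Set) → ℝ → BipGraph X
  proximinalGraph d A B δ = record
    { Vert = λ x → A x ⊎ B x
    ; Left = A
    ; Right = B
    ; Edge = λ a b → A a × B b × d a b ≡ δ }

-- Write δ = dist(A,B).  If diam B ≤ δ, then for a ∈ A and b, b' ∈ B the ultrametric
-- inequality gives d(a,b') ≤ max(d(a,b), d(b,b')), so an edge at a reaches every
-- vertex of B; and a point of A nearest to b ∈ B is at distance exactly δ from b,
-- because d(b,a') ≤ max(d(b,b'), d(b',a')) ≤ d(a',b') for all a' ∈ A, b' ∈ B.
-- Conversely, if every b ∈ B has a neighbour and G' is complete, two points b, b'
-- of B share a neighbour a, whence d(b,b') ≤ max(d(b,a), d(a,b')) = δ.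
module Submission where

open import Defs
open import Data.Product using (_×_; _,_; proj₁; proj₂; ∃)
open import Data.Sum using (_⊎_; inj₁; inj₂)
open import Data.Empty using (⊥; ⊥-elim)
open import Function.Bundles using (_⇔_; mk⇔)
open import Relation.Binary.PropositionalEquality using (_≡_; refl)
import Relation.Binary.PropositionalEquality as ≡
open import Relation.Binary.Structures using (IsTotalOrder)
open RealNumbers using (ℝ)
open Metric

module _ {V : Set} (G : BipGraph V) where
  open BipGraph G

  record IsBipartite : Set where
    field
      parts-disjoint : ∀ v → Left v → Right v → ⊥
      vert⇒part      : ∀ v → Vert v → Left v ⊎ Right v
      part⇒vert      : ∀ v → Left v ⊎ Right v → Vert v
      edge⇒parts     : ∀ u v → Edge u v → Left u × Right v

  module _ (bip : IsBipartite) where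
    open IsBipartite bip

    edge⇒nonIsolatedˡ : ∀ {u v} → Edge u v → NonIsolated G u
    edge⇒nonIsolatedˡ {u} {v} e with edge⇒parts u v e
    ... | Lu , _ = part⇒vert u (inj₁ Lu) , v , inj₁ e

    edge⇒nonIsolatedʳ : ∀ {u v} → Edge u v → NonIsolated G v
    edge⇒nonIsolatedʳ {u} {v} e with edge⇒parts u v e
    ... | _ , Rv = part⇒vert v (inj₂ Rv) , u , inj₂ e

    nonIsolated-left⇒edge : ∀ {u} → Left u → NonIsolated G u → ∃ λ w → Edge u w
    nonIsolated-left⇒edge     Lu (_ , w , inj₁ e) = w , e
    nonIsolated-left⇒edge {u} Lu (_ , w , inj₂ e) with edge⇒parts w u e
    ... | _ , Ru = ⊥-elim (parts-disjoint u Lu Ru)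

    nonIsolated-right⇒edge : ∀ {v} → Right v → NonIsolated G v → ∃ λ w → Edge w v
    nonIsolated-right⇒edge     Rv (_ , w , inj₂ e) = w , e
    nonIsolated-right⇒edge {v} Rv (_ , w , inj₁ e) with edge⇒parts v w e
    ... | Lv , _ = ⊥-elim (parts-disjoint v Lv Rv)

    prime-isCompleteBipartite :
      NonemptyGraph G →
      (∀ u v → Left u → NonIsolated G u → Right v → NonIsolated G v → Edge u v) →
      IsCompleteBipartite (prime G)
    prime-isCompleteBipartite (u , v , e) adjacent =
        (u , edge⇒parts' u v e .proj₁)
      , (v , edge⇒parts' u v e .proj₂)
      , (λ w (Lw , _) (Rw , _) → parts-disjoint w Lw Rw)
      , vert'⇒part'
      , (λ { w (inj₁ (_ , n)) → n ; w (inj₂ (_ , n)) → n })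
      , edge⇒parts'
      , (λ u' v' (Lu' , nu') (Rv' , nv') → adjacent u' v' Lu' nu' Rv' nv')
      where
      vert'⇒part' : ∀ w → NonIsolated G w →
                    (Left w × NonIsolated G w) ⊎ (Right w × NonIsolated G w)
      vert'⇒part' w n@(Vw , _) with vert⇒part w Vw
      ... | inj₁ Lw = inj₁ (Lw , n)
      ... | inj₂ Rw = inj₂ (Rw , n)
      edge⇒parts' : ∀ u' v' → Edge u' v' →
                    (Left u' × NonIsolated G u') × (Right v' × NonIsolated G v')
      edge⇒parts' u' v' e' with edge⇒parts u' v' e'
      ... | Lu' , Rv' = (Lu' , edge⇒nonIsolatedˡ e') , (Rv' , edge⇒nonIsolatedʳ e')

module _ (R : RealNumbers) {X : Set} (d : X → X → ℝ R) where
  open RealNumbers R hiding (ℝ)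
  private module ≤ = IsTotalOrder isTotalOrder

  IsDist⇒≤ : ∀ {A B δ a b} → IsDist R d A B δ → A a → B b → δ ≤ d a b
  IsDist⇒≤ {a = a} {b} (lower , _) Aa Bb = lower (d a b) (a , b , Aa , Bb , refl)

  DiamLe⇒≤ : ∀ {B δ b b'} → DiamLe R d B δ → B b → B b' → d b b' ≤ δ
  DiamLe⇒≤ {b = b} {b'} (s , (upper , _) , s≤δ) Bb Bb' =
    ≤.trans (upper (d b b') (b , b' , Bb , Bb' , refl)) s≤δ

  ≤⇒DiamLe : ∀ {B δ} → ∃ B → (∀ {b b'} → B b → B b' → d b b' ≤ δ) → DiamLe R d B δ
  ≤⇒DiamLe {B} {δ} (b , Bb) bounded =
    let s , upper , least =
          complete (DistsBetween R d B B) (d b b , b , b , Bb , Bb , refl) (δ , δ-upper)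
    in  s , (upper , least) , least δ δ-upper
    where
    δ-upper : ∀ s → DistsBetween R d B B s → s ≤ δ
    δ-upper _ (_ , _ , Bb₁ , Bb₂ , refl) = bounded Bb₁ Bb₂

  module _ (U : IsUltrametric R X d) where
    open IsUltrametric U using (ultra) renaming (sym to d-sym)

    ultra-≤ : ∀ {x y z t} → d x z ≤ t → d z y ≤ t → d x y ≤ t
    ultra-≤ {x} {y} {z} xz≤t zy≤t with ultra x y z
    ... | inj₁ xy≤xz = ≤.trans xy≤xz xz≤t
    ... | inj₂ xy≤zy = ≤.trans xy≤zy zy≤t

    module _ {A B δ} (dist : IsDist R d A B δ)
             (diam : ∀ {b b'} → B b → B b' → d b b' ≤ δ) where

      nearest-attains-dist : ∀ {b a₀} → B b → A a₀ →
                             IsInf R (DistsTo R d b A) (d b a₀) → d a₀ b ≡ δ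
      nearest-attains-dist {b} {a₀} Bb Aa₀ (nearest , _) =
        ≤.antisym (≤.trans (≤.reflexive (d-sym a₀ b)) (dist .proj₂ (d b a₀) below))
                  (IsDist⇒≤ dist Aa₀ Bb)
        where
        below : ∀ s → DistsBetween R d A B s → d b a₀ ≤ s
        below _ (a , b' , Aa , Bb' , refl) =
          ≤.trans (nearest (d b a) (a , Aa , refl))
                  (ultra-≤ (≤.trans (diam Bb Bb') (IsDist⇒≤ dist Aa Bb'))
                           (≤.reflexive (d-sym b' a)))

      dist-attained-at-all-of-B : ∀ {a b b'} → A a → B b → B b' → d a b ≡ δ → d a b' ≡ δ
      dist-attained-at-all-of-B Aa Bb Bb' ab≡δ =
        ≤.antisym (ultra-≤ (≤.reflexive ab≡δ) (diam Bb Bb')) (IsDist⇒≤ dist Aa Bb')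

module _ (R : RealNumbers) {X : Set} (d : X → X → ℝ R)
         {A B : X → Set} (disj : Disjoint R d A B) {δ : ℝ R} where
  open RealNumbers R using (_≤_; isTotalOrder)
  open BipGraph (proximinalGraph R d A B δ)
  private
    module ≤ = IsTotalOrder isTotalOrder
    G = proximinalGraph R d A B δ

  proximinalGraph-isBipartite : IsBipartite G
  proximinalGraph-isBipartite = record
    { parts-disjoint = disj
    ; vert⇒part      = λ _ v → v
    ; part⇒vert      = λ _ v → v
    ; edge⇒parts     = λ _ _ (Aa , Bb , _) → Aa , Bb
    }

  private bip = proximinalGraph-isBipartite

  module _ (U : IsUltrametric R X d) where

    DiamLe⇒prime-isCompleteBipartite :
      IsDist R d A B δ → Proximinal R d A → ∃ B → DiamLe R d B δ →
      NonemptyGraph G × IsCompleteBipartite (prime G) × (∀ b → B b → BipGraph.Vert (prime G) b)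
    DiamLe⇒prime-isCompleteBipartite dist proxA (b , Bb) diamLe =
      edge , prime-isCompleteBipartite G bip edge adjacent , covered
      where
      diam : ∀ {b b'} → B b → B b' → d b b' ≤ δ
      diam = DiamLe⇒≤ R d diamLe
      neighbour : ∀ {b} → B b → ∃ λ a → Edge a b
      neighbour {b} Bb =
        let a₀ , Aa₀ , nearest = proxA b
        in  a₀ , Aa₀ , Bb , nearest-attains-dist R d U dist diam Bb Aa₀ nearest
      edge : NonemptyGraph G
      edge = _ , _ , neighbour Bb .proj₂
      adjacent : ∀ u v → A u → NonIsolated G u → B v → NonIsolated G v → Edge u v
      adjacent u v Au nu Bv _ =
        let _ , _ , Bw , uw≡δ = nonIsolated-left⇒edge G bip Au nu
        in  Au , Bv , dist-attained-at-all-of-B R d U dist diam Au Bw Bv uw≡δ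
      covered : ∀ b → B b → NonIsolated G b
      covered b Bb = edge⇒nonIsolatedʳ G bip (neighbour Bb .proj₂)

    prime-isCompleteBipartite⇒DiamLe :
      ∃ B → NonemptyGraph G × IsCompleteBipartite (prime G) × (∀ b → B b → BipGraph.Vert (prime G) b) →
      DiamLe R d B δ
    prime-isCompleteBipartite⇒DiamLe inhabited (_ , (_ , _ , _ , _ , _ , _ , adjacent) , covered) =
      ≤⇒DiamLe R d inhabited bounded
      where
      bounded : ∀ {b b'} → B b → B b' → d b b' ≤ δ
      bounded {b} {b'} Bb Bb' =
        let a , Aa , _ , ab≡δ = nonIsolated-right⇒edge G bip Bb (covered b Bb)
            _ , _ , ab'≡δ = adjacent a b' (Aa , edge⇒nonIsolatedˡ G bip (Aa , Bb , ab≡δ))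
                                          (Bb' , covered b' Bb')
        in  ultra-≤ R d U (≤.reflexive (≡.trans (IsUltrametric.sym U b a) ab≡δ))
                          (≤.reflexive ab'≡δ)

proposition3p2 : (R : RealNumbers) →
    {X : Set} (d : X → X → ℝ R) → IsUltrametric R X d →
    (A B : X → Set) → Disjoint R d A B → Proximinal R d A → Proximinal R d B →
    (δ : ℝ R) → IsDist R d A B δ →
    DiamLe R d B δ ⇔
      (NonemptyGraph (proximinalGraph R d A B δ) ×
       IsCompleteBipartite (prime (proximinalGraph R d A B δ)) ×
       (∀ b → B b → BipGraph.Vert (prime (proximinalGraph R d A B δ)) b))
proposition3p2 R d U A B disj proxA proxB δ dist =
  mk⇔ (DiamLe⇒prime-isCompleteBipartite R d disj U dist proxA inhabited)
      (prime-isCompleteBipartite⇒DiamLe R d disj U inhabited)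
  where
  inhabited : ∃ B
  inhabited = let b , Bb , _ = proxB (IsUltrametric.nonempty U) in b , Bb
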